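{- $\mathsf{id}_6\le\mathsf{PHP}^9_4$ and $\mathsf{id}_{10}\le\mathsf{PHP}^7_5$.
   Context: A number $N\ge1$ is identified with $\{0,\dots,N-1\}$. A (finite) problem $\mathsf{P}$ consists of a nonempty finite set of instances and, for each instance $x$, a nonempty finite set $\mathsf{P}(x)$ of solutions. For finite problems, $\mathsf{P}\le\mathsf{Q}$ if there exist a map $\Phi$ sending each $\mathsf{P}$-instance $x$ to a $\mathsf{Q}$-instance and a (partial) map $\Psi$ on $\mathsf{Q}$-solutions such that $\Psi(y)\in\mathsf{P}(x)$ whenever $y\in\mathsf{Q}(\Phi(x))$. For $m>n\ge2$, $\mathsf{PHP}^m_n$ has as instances all functions $f:m\to n$, with solutions all unordered pairs $\{i,j\}$, $i\ne j$, $f(i)=f(j)$. For $k\ge1$, $\mathsf{id}_k$ has instances $j\in\{1,\dots,k\}$, each instance $j$ having unique solution $j$. -}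

module Defs where

open import Level using (0ℓ)
open import Data.Nat using (ℕ)
open import Data.Fin using (Fin; _<_)
open import Data.Product using (Σ; _×_; _,_)
open import Data.Maybe using (Maybe; just)
open import Relation.Binary.PropositionalEquality using (_≡_)

-- A problem: a type of instances, a type of candidate solutions (the union
-- of all solution sets), and the relation "s ∈ P(x)".
record Problem : Set₁ where
  field
    Inst  : Set
    Sol   : Set
    IsSol : Inst → Sol → Set
open Problem public

_≤ᵣ_ : Problem → Problem → Set
P ≤ᵣ Q =
  Σ (Inst P → Inst Q) λ Φ →
  Σ (Sol Q → Maybe (Sol P)) λ Ψ →
  ∀ (x : Inst P) (y : Sol Q) → IsSol Q (Φ x) y →
    Σ (Sol P) λ s → (Ψ y ≡ just s) × IsSol P x s

-- PHP^m_n: instances f : m → n; solutions unordered pairs {i,j}, i ≠ j,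
-- represented canonically as ordered pairs (i , j) with i < j.
PHP : ℕ → ℕ → Problem
PHP m n = record
  { Inst  = Fin m → Fin n
  ; Sol   = Fin m × Fin m
  ; IsSol = λ f p → let (i , j) = p in (i < j) × (f i ≡ f j)
  }

idP : ℕ → Problem
idP k = record
  { Inst  = Fin k
  ; Sol   = Fin k
  ; IsSol = λ j s → s ≡ j
  }

{-# OPTIONS --safe #-}
module Submission where

-- If k maps m → n have pairwise disjoint sets of collisions, then id_k ≤ PHP^m_n:
-- Φ sends j to the j-th map, and Ψ recovers j from any collision as the unique
-- map in which that collision occurs. For PHP^9_4 every map 9 → 4 collides on at
-- least 3 + 1 + 1 + 1 = 6 pairs, so six such maps must partition all 36 pairs of 9,
-- each collision graph being a triangle plus three disjoint edges; for PHP^7_5 every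
-- map 7 → 5 collides on at least 2 pairs, and ten maps use 20 of the 21 pairs of 7.
-- Disjointness of the explicit families is checked by exhaustive evaluation.

open import Defs
open import Data.Nat using (ℕ)
open import Data.Fin using (Fin; _<_; _<?_; _≟_; #_)
open import Data.Fin.Properties using (all?; any?)
open import Data.Maybe using (Maybe; just; nothing)
open import Data.Product using (Σ; _×_; _,_)
open import Data.Vec using (Vec; []; _∷_; lookup)
open import Relation.Nullary using (Dec; yes; no; contradiction)
open import Relation.Nullary.Decidable using (_→-dec_; from-yes)
open import Relation.Binary.PropositionalEquality using (_≡_; refl; cong)

module _ {k m n : ℕ} (c : Fin k → Fin m → Fin n) where

  CollisionsDisjoint : Set
  CollisionsDisjoint = ∀ x y i j → i < j → c x i ≡ c x j → c y i ≡ c y j → x ≡ y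

  collisionsDisjoint? : Dec CollisionsDisjoint
  collisionsDisjoint? = all? λ x → all? λ y → all? λ i → all? λ j →
    i <? j →-dec c x i ≟ c x j →-dec c y i ≟ c y j →-dec x ≟ y

  collidingMap : Fin m × Fin m → Maybe (Fin k)
  collidingMap (i , j) with any? (λ x → c x i ≟ c x j)
  ... | yes (x , _) = just x
  ... | no _        = nothing

  idP≤PHP : CollisionsDisjoint → idP k ≤ᵣ PHP m n
  idP≤PHP disjoint = c , collidingMap , recover
    where
    recover : ∀ x p → IsSol (PHP m n) (c x) p →
              Σ (Fin k) λ s → (collidingMap p ≡ just s) × (s ≡ x)
    recover x (i , j) (i<j , cxi≡cxj) with any? (λ y → c y i ≟ c y j)
    ... | yes (y , cyi≡cyj) = x , cong just (disjoint y x i j i<j cyi≡cyj cxi≡cxj) , refl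
    ... | no noCollision    = contradiction (x , cxi≡cxj) noCollision

tabulated : ∀ {k m n} → Vec (Vec (Fin n) m) k → Fin k → Fin m → Fin n
tabulated rows x = lookup (lookup rows x)

maps⁹₄ : Fin 6 → Fin 9 → Fin 4
maps⁹₄ = tabulated
  ( (# 0 ∷ # 0 ∷ # 0 ∷ # 1 ∷ # 1 ∷ # 2 ∷ # 2 ∷ # 3 ∷ # 3 ∷ [])
  ∷ (# 0 ∷ # 1 ∷ # 2 ∷ # 0 ∷ # 1 ∷ # 2 ∷ # 3 ∷ # 2 ∷ # 3 ∷ [])
  ∷ (# 0 ∷ # 1 ∷ # 2 ∷ # 1 ∷ # 3 ∷ # 0 ∷ # 2 ∷ # 3 ∷ # 1 ∷ [])
  ∷ (# 0 ∷ # 1 ∷ # 2 ∷ # 2 ∷ # 3 ∷ # 3 ∷ # 1 ∷ # 0 ∷ # 3 ∷ [])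
  ∷ (# 0 ∷ # 1 ∷ # 2 ∷ # 3 ∷ # 0 ∷ # 3 ∷ # 0 ∷ # 1 ∷ # 2 ∷ [])
  ∷ (# 0 ∷ # 1 ∷ # 2 ∷ # 3 ∷ # 2 ∷ # 1 ∷ # 3 ∷ # 3 ∷ # 0 ∷ [])
  ∷ [])

maps⁷₅ : Fin 10 → Fin 7 → Fin 5
maps⁷₅ = tabulated
  ( (# 0 ∷ # 0 ∷ # 1 ∷ # 1 ∷ # 2 ∷ # 3 ∷ # 4 ∷ [])
  ∷ (# 0 ∷ # 1 ∷ # 0 ∷ # 1 ∷ # 2 ∷ # 3 ∷ # 4 ∷ [])
  ∷ (# 0 ∷ # 1 ∷ # 1 ∷ # 0 ∷ # 2 ∷ # 3 ∷ # 4 ∷ [])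
  ∷ (# 0 ∷ # 1 ∷ # 2 ∷ # 3 ∷ # 0 ∷ # 1 ∷ # 4 ∷ [])
  ∷ (# 0 ∷ # 1 ∷ # 2 ∷ # 3 ∷ # 1 ∷ # 0 ∷ # 4 ∷ [])
  ∷ (# 0 ∷ # 1 ∷ # 2 ∷ # 3 ∷ # 2 ∷ # 4 ∷ # 0 ∷ [])
  ∷ (# 0 ∷ # 1 ∷ # 2 ∷ # 3 ∷ # 3 ∷ # 4 ∷ # 1 ∷ [])
  ∷ (# 0 ∷ # 1 ∷ # 2 ∷ # 3 ∷ # 4 ∷ # 2 ∷ # 3 ∷ [])
  ∷ (# 0 ∷ # 1 ∷ # 2 ∷ # 3 ∷ # 4 ∷ # 3 ∷ # 4 ∷ [])
  ∷ (# 0 ∷ # 1 ∷ # 2 ∷ # 3 ∷ # 4 ∷ # 4 ∷ # 2 ∷ [])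
  ∷ [])

proposition5p1 : (idP 6 ≤ᵣ PHP 9 4) × (idP 10 ≤ᵣ PHP 7 5)
proposition5p1 = idP≤PHP maps⁹₄ (from-yes (collisionsDisjoint? maps⁹₄))
               , idP≤PHP maps⁷₅ (from-yes (collisionsDisjoint? maps⁷₅))
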